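{- Let $q$ be a prime power and let $P\subset\mathbb{F}_q^2$ be an arc with $|P|=k\leq\sqrt q$. Then \[ \frac{q}{2}\binom{k}{2}\leq |\mathcal{L}_P|\leq q\binom{k}{2}. \]
   Context: $\mathbb{F}_q$ is the finite field with $q$ elements. An arc is a subset of $\mathbb{F}_q^2$ with no three points on a common affine line. $L(P)$ denotes the set of affine lines in $\mathbb{F}_q^2$ containing at least two points of $P$, and $\mathcal{L}_P=\bigcup_{\ell\in L(P)}\ell$ is the set of all points of $\mathbb{F}_q^2$ lying on some line of $L(P)$. -}

module Defs where

open import Level using (0ℓ)
open import Data.Nat using (ℕ; suc; _^_)
open import Data.Nat.Primality using (Prime)
open import Data.Product using (Σ; ∃; ∃-syntax; _×_; _,_)
open import Data.List using (List; length)
open import Data.List.Membership.Propositional using (_∈_)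
open import Data.List.Relation.Unary.Unique.Propositional using (Unique)
open import Relation.Binary.PropositionalEquality using (_≡_)
open import Relation.Nullary using (¬_; Dec)
open import Algebra.Structures using (IsCommutativeRing)

IsPrimePower : ℕ → Set
IsPrimePower q = Σ ℕ λ p → Σ ℕ λ e → Prime p × q ≡ p ^ suc e

record FiniteField (q : ℕ) : Set₁ where
  field
    Carrier  : Set
    _+_ _*_  : Carrier → Carrier → Carrier
    -_       : Carrier → Carrier
    0# 1#    : Carrier
    isCommutativeRing : IsCommutativeRing _≡_ _+_ _*_ -_ 0# 1#
    0≢1      : ¬ (0# ≡ 1#)
    inverse  : ∀ x → ¬ (x ≡ 0#) → ∃[ y ] (x * y ≡ 1#)
    _≟_      : (x y : Carrier) → Dec (x ≡ y)
    elements : List Carrier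
    elements-unique   : Unique elements
    elements-complete : ∀ x → x ∈ elements
    elements-length   : length elements ≡ q

module Plane {q : ℕ} (F : FiniteField q) where
  open FiniteField F

  Point : Set
  Point = Carrier × Carrier

  record Line : Set where
    constructor line
    field
      base      : Point
      direction : Point
      nonzero   : ¬ (direction ≡ (0# , 0#))

  _∈ₗ_ : Point → Line → Set
  (x , y) ∈ₗ line (a , b) (u , v) _ = ∃[ t ] ((x ≡ a + (t * u)) × (y ≡ b + (t * v)))

  IsArc : List Point → Set
  IsArc P = Unique P ×
    (∀ ℓ p₁ p₂ p₃ → p₁ ∈ P → p₂ ∈ P → p₃ ∈ P →
       ¬ (p₁ ≡ p₂) → ¬ (p₁ ≡ p₃) → ¬ (p₂ ≡ p₃) →
       p₁ ∈ₗ ℓ → p₂ ∈ₗ ℓ → ¬ (p₃ ∈ₗ ℓ))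

  InL : List Point → Line → Set
  InL P ℓ = ∃[ p₁ ] ∃[ p₂ ] (p₁ ∈ P × p₂ ∈ P × ¬ (p₁ ≡ p₂) × p₁ ∈ₗ ℓ × p₂ ∈ₗ ℓ)

  In𝓛 : List Point → Point → Set
  In𝓛 P z = ∃[ ℓ ] (InL P ℓ × z ∈ₗ ℓ)

  -- S is an explicit (duplicate-free) listing of the set 𝓛_P, so |𝓛_P| = length S
  Enumerates𝓛 : List Point → List Point → Set
  Enumerates𝓛 P S = Unique S × (∀ z → (z ∈ S → In𝓛 P z) × (In𝓛 P z → z ∈ S))

module Submission where

-- Let N = k C 2 be the number of secants of P. Each secant has q points and 𝓛_P is their
-- union, so |𝓛_P| ≤ N q. Two distinct secants share at most one point: if they shared two
-- they would coincide, and that line would contain three points of the arc. So, adding the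
-- secants one at a time, each loses at most one point to every earlier one, and
-- |𝓛_P| ≥ N q − N C 2. Finally k² ≤ q gives N ≤ q, hence 2 (N C 2) ≤ N² ≤ N q and
-- 2 |𝓛_P| ≥ N q.

open import Defs
open import Level using (0ℓ)
open import Algebra.Bundles using (CommutativeRing)
open import Data.Product using (_×_; _,_; proj₁; proj₂; ∃-syntax)
open import Data.Product.Properties using (≡-dec)
open import Data.Empty using (⊥; ⊥-elim)
open import Data.Sum using (_⊎_; inj₁; inj₂)
open import Data.List using (List; []; _∷_; length; map; concatMap; filter; _++_)
open import Data.List.Properties using (length-map; length-++; filter-notAll)
open import Data.List.Membership.Propositional using (_∈_)
open import Data.List.Membership.Propositional.Properties
  using (∈-filter⁺; ∈-filter⁻; ∈-map⁺; ∈-map⁻; ∈-++⁺ˡ; ∈-++⁺ʳ; ∈-++⁻; ∈-concat⁺′)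
open import Data.List.Relation.Binary.Subset.Propositional using (_⊆_)
open import Data.List.Relation.Unary.Any as Any using (here; there)
open import Data.List.Relation.Unary.All as All using (All; []; _∷_)
import Data.List.Relation.Unary.All.Properties as All
open import Data.List.Relation.Unary.AllPairs as AllPairs using (AllPairs; []; _∷_)
import Data.List.Relation.Unary.AllPairs.Properties as AllPairs
open import Data.List.Relation.Unary.Unique.Propositional using (Unique)
import Data.List.Relation.Unary.Unique.Propositional.Properties as Unique
open import Relation.Binary.Definitions using (DecidableEquality)
open import Relation.Binary.PropositionalEquality
open import Relation.Nullary using (¬_; Dec; yes; no; ¬?)
open import Relation.Nullary.Negation using (contradiction)
open import Function using (_∘_; _on_)

module FieldProperties {q} (F : FiniteField q) where
  open FiniteField F using (isCommutativeRing; inverse)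

  commutativeRing : CommutativeRing 0ℓ 0ℓ
  commutativeRing = record { isCommutativeRing = isCommutativeRing }

  open CommutativeRing commutativeRing hiding (refl; sym; trans)
  open import Algebra.Properties.Ring ring using ([y-z]x≈yx-zx)
  open import Algebra.Properties.AbelianGroup +-abelianGroup using (x∙y⁻¹≈ε⇒x≈y; ⁻¹-∙-comm)
  open import Algebra.Properties.CommutativeSemigroup *-commutativeSemigroup using (xy∙z≈y∙zx)
  open ≡-Reasoning

  x+[y-x]≡y : ∀ x y → x + (y - x) ≡ y
  x+[y-x]≡y x y = begin
    x + (y - x)   ≡⟨ cong (x +_) (+-comm y (- x)) ⟩
    x + (- x + y) ≡⟨ +-assoc x (- x) y ⟨
    x - x + y     ≡⟨ cong (_+ y) (-‿inverseʳ x) ⟩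
    0# + y        ≡⟨ +-identityˡ y ⟩
    y             ∎

  [x+y]-[x+z]≡y-z : ∀ x y z → (x + y) - (x + z) ≡ y - z
  [x+y]-[x+z]≡y-z x y z = begin
    (x + y) + - (x + z)   ≡⟨ cong ((x + y) +_) (⁻¹-∙-comm x z) ⟨
    (x + y) + (- x - z)   ≡⟨ cong (_+ (- x - z)) (+-comm x y) ⟩
    (y + x) + (- x - z)   ≡⟨ +-assoc y x (- x - z) ⟩
    y + (x + (- x - z))   ≡⟨ cong (y +_) (+-assoc x (- x) (- z)) ⟨
    y + ((x - x) - z)     ≡⟨ cong (λ w → y + (w - z)) (-‿inverseʳ x) ⟩
    y + (0# - z)          ≡⟨ cong (y +_) (+-identityˡ (- z)) ⟩
    y - z                 ∎

  x-y≡0⇒x≡y : ∀ {x y} → x - y ≡ 0# → x ≡ y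
  x-y≡0⇒x≡y = x∙y⁻¹≈ε⇒x≈y _ _

  x*y≡0⇒y≡0 : ∀ {x y} → x ≢ 0# → x * y ≡ 0# → y ≡ 0#
  x*y≡0⇒y≡0 {x} {y} x≢0 xy≡0 with inverse x x≢0
  ... | x⁻¹ , xx⁻¹≡1 = begin
    y               ≡⟨ *-identityˡ y ⟨
    1# * y          ≡⟨ cong (_* y) xx⁻¹≡1 ⟨
    (x * x⁻¹) * y   ≡⟨ xy∙z≈y∙zx x x⁻¹ y ⟩
    x⁻¹ * (y * x)   ≡⟨ cong (x⁻¹ *_) (*-comm y x) ⟩
    x⁻¹ * (x * y)   ≡⟨ cong (x⁻¹ *_) xy≡0 ⟩
    x⁻¹ * 0#        ≡⟨ zeroʳ x⁻¹ ⟩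
    0#              ∎

  [c+su]-[c+tu]≡[s-t]u : ∀ c u s t → (c + s * u) - (c + t * u) ≡ (s - t) * u
  [c+su]-[c+tu]≡[s-t]u c u s t = trans ([x+y]-[x+z]≡y-z c (s * u) (t * u)) (sym ([y-z]x≈yx-zx u s t))

  affine-reparametrise : ∀ c u t₁ t₂ s →
                         (c + t₁ * u) + s * ((c + t₂ * u) - (c + t₁ * u)) ≡ c + (t₁ + s * (t₂ - t₁)) * u
  affine-reparametrise c u t₁ t₂ s = begin
    (c + t₁ * u) + s * ((c + t₂ * u) - (c + t₁ * u))
      ≡⟨ cong (λ w → (c + t₁ * u) + s * w) ([c+su]-[c+tu]≡[s-t]u c u t₂ t₁) ⟩
    (c + t₁ * u) + s * ((t₂ - t₁) * u)               ≡⟨ cong ((c + t₁ * u) +_) (*-assoc s (t₂ - t₁) u) ⟨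
    (c + t₁ * u) + (s * (t₂ - t₁)) * u               ≡⟨ +-assoc c (t₁ * u) _ ⟩
    c + (t₁ * u + (s * (t₂ - t₁)) * u)               ≡⟨ cong (c +_) (distribʳ u t₁ _) ⟨
    c + (t₁ + s * (t₂ - t₁)) * u                     ∎

  affine-cancel : ∀ c u s t → c + s * u ≡ c + t * u → (s - t) * u ≡ 0#
  affine-cancel c u s t eq = begin
    (s - t) * u                    ≡⟨ [c+su]-[c+tu]≡[s-t]u c u s t ⟨
    (c + s * u) - (c + t * u)      ≡⟨ cong (_- (c + t * u)) eq ⟩
    (c + t * u) - (c + t * u)      ≡⟨ -‿inverseʳ (c + t * u) ⟩
    0#                             ∎

  t₁+e[t-t₁][t₂-t₁]≡t : ∀ {t₁ t₂ e} t → (t₂ - t₁) * e ≡ 1# → t₁ + (e * (t - t₁)) * (t₂ - t₁) ≡ t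
  t₁+e[t-t₁][t₂-t₁]≡t {t₁} {t₂} {e} t de≡1 = begin
    t₁ + (e * (t - t₁)) * (t₂ - t₁)   ≡⟨ cong (t₁ +_) (xy∙z≈y∙zx e (t - t₁) (t₂ - t₁)) ⟩
    t₁ + (t - t₁) * ((t₂ - t₁) * e)   ≡⟨ cong (λ w → t₁ + (t - t₁) * w) de≡1 ⟩
    t₁ + (t - t₁) * 1#                ≡⟨ cong (t₁ +_) (*-identityʳ (t - t₁)) ⟩
    t₁ + (t - t₁)                     ≡⟨ x+[y-x]≡y t₁ t ⟩
    t                                 ∎

module AffinePlane {q} (F : FiniteField q) where
  open FiniteField F using (Carrier; _≟_; inverse; elements; elements-unique; elements-complete)
  open FieldProperties F
  open CommutativeRing commutativeRing using (_+_; _*_; _-_; 0#; 1#; +-identityʳ; *-identityˡ; zeroˡ)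
  open Plane F

  infixl 6 _+ᵥ_ _-ᵥ_
  infixr 7 _·ᵥ_

  _+ᵥ_ _-ᵥ_ : Point → Point → Point
  (x₁ , x₂) +ᵥ (y₁ , y₂) = (x₁ + y₁ , x₂ + y₂)
  (x₁ , x₂) -ᵥ (y₁ , y₂) = (x₁ - y₁ , x₂ - y₂)

  _·ᵥ_ : Carrier → Point → Point
  t ·ᵥ (x₁ , x₂) = (t * x₁ , t * x₂)

  pointOn : Line → Carrier → Point
  pointOn (line a d _) t = a +ᵥ t ·ᵥ d

  ∈ₗ⇒≡pointOn : ∀ {z} ℓ → z ∈ₗ ℓ → ∃[ t ] z ≡ pointOn ℓ t
  ∈ₗ⇒≡pointOn _ (t , z₁≡ , z₂≡) = t , cong₂ _,_ z₁≡ z₂≡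

  ≡pointOn⇒∈ₗ : ∀ {z} ℓ t → z ≡ pointOn ℓ t → z ∈ₗ ℓ
  ≡pointOn⇒∈ₗ _ t z≡ = t , cong proj₁ z≡ , cong proj₂ z≡

  pointOn-injective : ∀ ℓ {s t} → pointOn ℓ s ≡ pointOn ℓ t → s ≡ t
  pointOn-injective (line (c₁ , c₂) (u₁ , u₂) d≢0) {s} {t} eq with (s - t) ≟ 0#
  ... | yes s-t≡0 = x-y≡0⇒x≡y s-t≡0
  ... | no  s-t≢0 = contradiction
    (cong₂ _,_ (x*y≡0⇒y≡0 s-t≢0 (affine-cancel c₁ u₁ s t (cong proj₁ eq)))
               (x*y≡0⇒y≡0 s-t≢0 (affine-cancel c₂ u₂ s t (cong proj₂ eq))))
    d≢0

  secant : (a b : Point) → a ≢ b → Line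
  secant a b a≢b = line a (b -ᵥ a) λ b-a≡0 →
    a≢b (sym (cong₂ _,_ (x-y≡0⇒x≡y (cong proj₁ b-a≡0)) (x-y≡0⇒x≡y (cong proj₂ b-a≡0))))

  start∈secant : ∀ {a b} (a≢b : a ≢ b) → a ∈ₗ secant a b a≢b
  start∈secant {a₁ , a₂} _ = 0# , sym (a+0d≡a a₁) , sym (a+0d≡a a₂)
    where
    a+0d≡a : ∀ a {d} → a + 0# * d ≡ a
    a+0d≡a a {d} = trans (cong (a +_) (zeroˡ d)) (+-identityʳ a)

  end∈secant : ∀ {a b} (a≢b : a ≢ b) → b ∈ₗ secant a b a≢b
  end∈secant {a₁ , a₂} {b₁ , b₂} _ = 1# , sym (a+1[b-a]≡b a₁ b₁) , sym (a+1[b-a]≡b a₂ b₂)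
    where
    a+1[b-a]≡b : ∀ a b → a + 1# * (b - a) ≡ b
    a+1[b-a]≡b a b = trans (cong (a +_) (*-identityˡ (b - a))) (x+[y-x]≡y a b)

  pointOn-secant : ∀ ℓ {a b t₁ t₂} (a≢b : a ≢ b) → a ≡ pointOn ℓ t₁ → b ≡ pointOn ℓ t₂ →
                   ∀ s → pointOn (secant a b a≢b) s ≡ pointOn ℓ (t₁ + s * (t₂ - t₁))
  pointOn-secant (line (c₁ , c₂) (u₁ , u₂) _) _ refl refl s =
    cong₂ _,_ (affine-reparametrise c₁ u₁ _ _ s) (affine-reparametrise c₂ u₂ _ _ s)

  _⊆ₗ_ : Line → Line → Set
  ℓ ⊆ₗ ℓ′ = ∀ {z} → z ∈ₗ ℓ → z ∈ₗ ℓ′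

  secant-⊆ₗ : ∀ ℓ {a b} (a≢b : a ≢ b) → a ∈ₗ ℓ → b ∈ₗ ℓ → secant a b a≢b ⊆ₗ ℓ
  secant-⊆ₗ ℓ a≢b a∈ℓ b∈ℓ z∈ab
    with t₁ , a≡ ← ∈ₗ⇒≡pointOn ℓ a∈ℓ | t₂ , b≡ ← ∈ₗ⇒≡pointOn ℓ b∈ℓ
       | s , z≡ ← ∈ₗ⇒≡pointOn (secant _ _ a≢b) z∈ab
    = ≡pointOn⇒∈ₗ ℓ _ (trans z≡ (pointOn-secant ℓ a≢b a≡ b≡ s))

  ⊆ₗ-secant : ∀ ℓ {a b} (a≢b : a ≢ b) → a ∈ₗ ℓ → b ∈ₗ ℓ → ℓ ⊆ₗ secant a b a≢b
  ⊆ₗ-secant ℓ a≢b a∈ℓ b∈ℓ {z} z∈ℓ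
    with t₁ , a≡ ← ∈ₗ⇒≡pointOn ℓ a∈ℓ | t₂ , b≡ ← ∈ₗ⇒≡pointOn ℓ b∈ℓ | t , z≡ ← ∈ₗ⇒≡pointOn ℓ z∈ℓ
       | (t₂ - t₁) ≟ 0#
  ... | yes t₂-t₁≡0 =
    contradiction (trans a≡ (trans (cong (pointOn ℓ) (sym (x-y≡0⇒x≡y t₂-t₁≡0))) (sym b≡))) a≢b
  ... | no  t₂-t₁≢0 with e , de≡1 ← inverse (t₂ - t₁) t₂-t₁≢0 =
    ≡pointOn⇒∈ₗ (secant _ _ a≢b) (e * (t - t₁)) (begin
      z                                          ≡⟨ z≡ ⟩
      pointOn ℓ t                                ≡⟨ cong (pointOn ℓ) (t₁+e[t-t₁][t₂-t₁]≡t t de≡1) ⟨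
      pointOn ℓ (t₁ + e * (t - t₁) * (t₂ - t₁))  ≡⟨ pointOn-secant ℓ a≢b a≡ b≡ (e * (t - t₁)) ⟨
      pointOn (secant _ _ a≢b) (e * (t - t₁))    ∎)
    where open ≡-Reasoning

  ⊆ₗ-of-two-common-points : ∀ ℓ ℓ′ {x y} → x ≢ y → x ∈ₗ ℓ → y ∈ₗ ℓ → x ∈ₗ ℓ′ → y ∈ₗ ℓ′ → ℓ ⊆ₗ ℓ′
  ⊆ₗ-of-two-common-points ℓ ℓ′ x≢y x∈ℓ y∈ℓ x∈ℓ′ y∈ℓ′ =
    secant-⊆ₗ ℓ′ x≢y x∈ℓ′ y∈ℓ′ ∘ ⊆ₗ-secant ℓ x≢y x∈ℓ y∈ℓ

  pointsOn : Line → List Point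
  pointsOn ℓ = map (pointOn ℓ) elements

  pointsOn-unique : ∀ ℓ → Unique (pointsOn ℓ)
  pointsOn-unique ℓ = Unique.map⁺ (pointOn-injective ℓ) elements-unique

  ∈-pointsOn⁺ : ∀ {z} ℓ → z ∈ₗ ℓ → z ∈ pointsOn ℓ
  ∈-pointsOn⁺ ℓ z∈ℓ with t , refl ← ∈ₗ⇒≡pointOn ℓ z∈ℓ = ∈-map⁺ (pointOn ℓ) (elements-complete t)

  ∈-pointsOn⁻ : ∀ {z} ℓ → z ∈ pointsOn ℓ → z ∈ₗ ℓ
  ∈-pointsOn⁻ ℓ z∈ with t , _ , z≡ ← ∈-map⁻ (pointOn ℓ) z∈ = ≡pointOn⇒∈ₗ ℓ t z≡

open import Data.Nat using (ℕ; zero; suc; _+_; _*_; _≤_; z≤n; s≤s)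
open import Data.Nat.Properties
  using (≤-trans; ≤-reflexive; m≤n*m; m≤m+n; m+n≤o⇒m≤o; +-suc; +-mono-≤; +-monoˡ-≤; +-monoʳ-≤;
         +-cancelʳ-≤; *-comm; *-monoʳ-≤; *-distribˡ-+; module ≤-Reasoning)
open import Data.Nat.Combinatorics using (_C_; nC1≡n; nCk+nC[k+1]≡[n+1]C[k+1])
open import Data.Nat.Tactic.RingSolver using (solve-∀)

[1+n]C2≡n+nC2 : ∀ n → suc n C 2 ≡ n + n C 2
[1+n]C2≡n+nC2 n = trans (sym (nCk+nC[k+1]≡[n+1]C[k+1] n 1)) (cong (_+ n C 2) (nC1≡n n))

2*nC2+n≡n*n : ∀ n → 2 * (n C 2) + n ≡ n * n
2*nC2+n≡n*n zero    = refl
2*nC2+n≡n*n (suc n) = begin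
  2 * (suc n C 2) + suc n       ≡⟨ cong (λ c → 2 * c + suc n) ([1+n]C2≡n+nC2 n) ⟩
  2 * (n + n C 2) + suc n       ≡⟨ regroup n (n C 2) ⟩
  (2 * (n C 2) + n) + (2 * n + 1) ≡⟨ cong (_+ (2 * n + 1)) (2*nC2+n≡n*n n) ⟩
  n * n + (2 * n + 1)           ≡⟨ square n ⟩
  suc n * suc n                 ∎
  where
  open ≡-Reasoning
  regroup : ∀ n c → 2 * (n + c) + suc n ≡ (2 * c + n) + (2 * n + 1)
  regroup = solve-∀
  square : ∀ n → n * n + (2 * n + 1) ≡ suc n * suc n
  square = solve-∀

nC2≤n*n : ∀ n → n C 2 ≤ n * n
nC2≤n*n n = ≤-trans (m≤n*m (n C 2) 2) (≤-trans (m≤m+n (2 * (n C 2)) n) (≤-reflexive (2*nC2+n≡n*n n)))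

n*q≤s+nC2⇒q*n≤2*s : ∀ {n q s} → n ≤ q → n * q ≤ s + n C 2 → q * n ≤ 2 * s
n*q≤s+nC2⇒q*n≤2*s {n} {q} {s} n≤q nq≤s+nC2 =
  subst (_≤ 2 * s) (*-comm n q) (+-cancelʳ-≤ (n * q) (n * q) (2 * s) (begin
  n * q + n * q             ≡⟨ m+m≡2*m (n * q) ⟩
  2 * (n * q)               ≤⟨ *-monoʳ-≤ 2 nq≤s+nC2 ⟩
  2 * (s + n C 2)           ≡⟨ *-distribˡ-+ 2 s (n C 2) ⟩
  2 * s + 2 * (n C 2)       ≤⟨ +-monoʳ-≤ (2 * s) (m+n≤o⇒m≤o (2 * (n C 2)) (≤-reflexive (2*nC2+n≡n*n n))) ⟩
  2 * s + n * n             ≤⟨ +-monoʳ-≤ (2 * s) (*-monoʳ-≤ n n≤q) ⟩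
  2 * s + n * q             ∎))
  where
  open ≤-Reasoning
  m+m≡2*m : ∀ m → m + m ≡ 2 * m
  m+m≡2*m = solve-∀

module _ {A : Set} where

  length-filter-∁ : ∀ {P : A → Set} (P? : ∀ x → Dec (P x)) xs →
                    length xs ≡ length (filter P? xs) + length (filter (¬? ∘ P?) xs)
  length-filter-∁ P? []       = refl
  length-filter-∁ P? (x ∷ xs) with P? x
  ... | yes _ = cong suc (length-filter-∁ P? xs)
  ... | no  _ = trans (cong suc (length-filter-∁ P? xs)) (sym (+-suc _ _))

  length-concatMap : ∀ {I : Set} n (f : I → List A) → (∀ i → length (f i) ≡ n) →
                     ∀ is → length (concatMap f is) ≡ length is * n
  length-concatMap n f length-f≡n []       = refl
  length-concatMap n f length-f≡n (i ∷ is) =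
    trans (length-++ (f i)) (cong₂ _+_ (length-f≡n i) (length-concatMap n f length-f≡n is))

  AllPairs-mapWithAll : ∀ {P : A → Set} {R S : A → A → Set} {xs} → All P xs → AllPairs R xs →
                        (∀ {x y} → P x → P y → R x y → S x y) → AllPairs S xs
  AllPairs-mapWithAll []         []         f = []
  AllPairs-mapWithAll (px ∷ pxs) (rx ∷ rxs) f =
    All.zipWith (λ (py , r) → f px py r) (pxs , rx) ∷ AllPairs-mapWithAll pxs rxs f

  pairs : List A → List (A × A)
  pairs []       = []
  pairs (x ∷ xs) = map (x ,_) xs ++ pairs xs

  length-pairs : ∀ xs → length (pairs xs) ≡ length xs C 2
  length-pairs []       = refl
  length-pairs (x ∷ xs) = begin
    length (map (x ,_) xs ++ pairs xs)          ≡⟨ length-++ (map (x ,_) xs) ⟩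
    length (map (x ,_) xs) + length (pairs xs)  ≡⟨ cong₂ _+_ (length-map (x ,_) xs) (length-pairs xs) ⟩
    length xs + length xs C 2                   ≡⟨ [1+n]C2≡n+nC2 (length xs) ⟨
    suc (length xs) C 2                         ∎
    where open ≡-Reasoning

  ∈-pairs⁻ : ∀ {xs a b} → Unique xs → (a , b) ∈ pairs xs → a ∈ xs × b ∈ xs × a ≢ b
  ∈-pairs⁻ {x ∷ xs} (x∉xs ∷ uxs) m with ∈-++⁻ (map (x ,_) xs) m
  ... | inj₁ m′ with ∈-map⁻ (x ,_) m′
  ...   | y , y∈xs , refl = here refl , there y∈xs , All.lookup x∉xs y∈xs
  ∈-pairs⁻ {x ∷ xs} (x∉xs ∷ uxs) m | inj₂ m′ with ∈-pairs⁻ uxs m′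
  ... | a∈xs , b∈xs , a≢b = there a∈xs , there b∈xs , a≢b

  ∈-pairs⁺ : ∀ {xs a b} → a ∈ xs → b ∈ xs → a ≢ b → (a , b) ∈ pairs xs ⊎ (b , a) ∈ pairs xs
  ∈-pairs⁺ {x ∷ xs} (here refl) (here refl) a≢b = contradiction refl a≢b
  ∈-pairs⁺ {x ∷ xs} (here refl) (there b∈xs) _ = inj₁ (∈-++⁺ˡ (∈-map⁺ (x ,_) b∈xs))
  ∈-pairs⁺ {x ∷ xs} (there a∈xs) (here refl) _ = inj₂ (∈-++⁺ˡ (∈-map⁺ (x ,_) a∈xs))
  ∈-pairs⁺ {x ∷ xs} (there a∈xs) (there b∈xs) a≢b with ∈-pairs⁺ a∈xs b∈xs a≢b
  ... | inj₁ m = inj₁ (∈-++⁺ʳ (map (x ,_) xs) m)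
  ... | inj₂ m = inj₂ (∈-++⁺ʳ (map (x ,_) xs) m)

module Counting {A : Set} (_≟_ : DecidableEquality A) where
  open import Data.List.Membership.DecPropositional _≟_ using (_∈?_)

  _⊈₂_ : A × A → A × A → Set
  (c , d) ⊈₂ (a , b) = (a ≢ c × b ≢ c) ⊎ (a ≢ d × b ≢ d)

  pairs-⊈₂ : ∀ {xs} → Unique xs → AllPairs (λ p p′ → p′ ⊈₂ p) (pairs xs)
  pairs-⊈₂ {[]}     []           = []
  pairs-⊈₂ {x ∷ xs} (x∉xs ∷ uxs) =
    AllPairs.++⁺ sameFirst (pairs-⊈₂ uxs) (All.map⁺ (All.tabulate λ y∈xs → All.tabulate (across y∈xs)))
    where
    sameFirst : AllPairs (λ p p′ → p′ ⊈₂ p) (map (x ,_) xs)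
    sameFirst = AllPairs.map⁺ (AllPairs-mapWithAll x∉xs uxs λ _ x≢y′ y≢y′ → inj₂ (x≢y′ , y≢y′))
    across : ∀ {y} → y ∈ xs → ∀ {p} → p ∈ pairs xs → p ⊈₂ (x , y)
    across {y} _ {c , d} cd∈ with ∈-pairs⁻ uxs cd∈ | y ≟ c
    ... | c∈xs , d∈xs , c≢d | yes refl = inj₂ (All.lookup x∉xs d∈xs , c≢d)
    ... | c∈xs , d∈xs , c≢d | no y≢c   = inj₁ (All.lookup x∉xs c∈xs , y≢c)

  _∖_ : List A → List A → List A
  xs ∖ L = filter (λ x → ¬? (x ∈? L)) xs

  ∖-⊆ : ∀ {xs} L → xs ∖ L ⊆ xs
  ∖-⊆ L x∈ = proj₁ (∈-filter⁻ (λ x → ¬? (x ∈? L)) x∈)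

  ∖-mono : ∀ {xs ys} L → xs ⊆ ys → xs ∖ L ⊆ ys ∖ L
  ∖-mono L xs⊆ys x∈ with ∈-filter⁻ (λ x → ¬? (x ∈? L)) x∈
  ... | x∈xs , x∉L = ∈-filter⁺ (λ x → ¬? (x ∈? L)) (xs⊆ys x∈xs) x∉L

  Unique⇒length≤ : ∀ {xs ys} → Unique xs → xs ⊆ ys → length xs ≤ length ys
  Unique⇒length≤ {[]}     _            _        = z≤n
  Unique⇒length≤ {x ∷ xs} {ys} (x∉xs ∷ uxs) x∷xs⊆ys = begin-strict
    length xs                 ≤⟨ Unique⇒length≤ uxs xs⊆ys-x ⟩
    length (filter x≢? ys)    <⟨ filter-notAll x≢? ys (Any.map (λ x≡y x≢y → x≢y x≡y) x∈ys) ⟩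
    length ys                 ∎
    where
    open ≤-Reasoning
    x≢? = λ y → ¬? (x ≟ y)
    x∈ys = x∷xs⊆ys (here refl)
    xs⊆ys-x : xs ⊆ filter x≢? ys
    xs⊆ys-x z∈xs = ∈-filter⁺ x≢? (x∷xs⊆ys (there z∈xs)) (All.lookup x∉xs z∈xs)

  MeetInAtMostOne : List A → List A → Set
  MeetInAtMostOne L L′ = ∀ {x y} → x ∈ L → x ∈ L′ → y ∈ L → y ∈ L′ → x ≡ y

  MeetInAtMostOne-⊆ : ∀ {L₁ L₂ L₁′ L₂′} → L₁′ ⊆ L₁ → L₂′ ⊆ L₂ →
                      MeetInAtMostOne L₁ L₂ → MeetInAtMostOne L₁′ L₂′
  MeetInAtMostOne-⊆ ⊆₁ ⊆₂ meet x₁ x₂ y₁ y₂ = meet (⊆₁ x₁) (⊆₂ x₂) (⊆₁ y₁) (⊆₂ y₂)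

  length-≤1 : ∀ {xs : List A} → Unique xs → (∀ {x y} → x ∈ xs → y ∈ xs → x ≡ y) → length xs ≤ 1
  length-≤1 {[]}         _                  _     = z≤n
  length-≤1 {x ∷ []}     _                  _     = s≤s z≤n
  length-≤1 {x ∷ y ∷ xs} ((x≢y ∷ _) ∷ _)   equal = contradiction (equal (here refl) (there (here refl))) x≢y

  length≤1+length-∖ : ∀ {L L′} → Unique L′ → MeetInAtMostOne L L′ → length L′ ≤ suc (length (L′ ∖ L))
  length≤1+length-∖ {L} {L′} uL′ meet = begin
    length L′                                        ≡⟨ length-filter-∁ (_∈? L) L′ ⟩
    length (filter (_∈? L) L′) + length (L′ ∖ L)
      ≤⟨ +-monoˡ-≤ _ (length-≤1 (Unique.filter⁺ (_∈? L) uL′) inBoth) ⟩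
    suc (length (L′ ∖ L))                            ∎
    where
    open ≤-Reasoning
    inBoth : ∀ {x y} → x ∈ filter (_∈? L) L′ → y ∈ filter (_∈? L) L′ → x ≡ y
    inBoth x∈ y∈ with ∈-filter⁻ (_∈? L) x∈ | ∈-filter⁻ (_∈? L) y∈
    ... | x∈L′ , x∈L | y∈L′ , y∈L = meet x∈L x∈L′ y∈L y∈L′

  length+length-∖≤ : ∀ {L S} → Unique L → L ⊆ S → length L + length (S ∖ L) ≤ length S
  length+length-∖≤ {L} {S} uL L⊆S = begin
    length L + length (S ∖ L)                        ≤⟨ +-monoˡ-≤ _ (Unique⇒length≤ uL L⊆S∩L) ⟩
    length (filter (_∈? L) S) + length (S ∖ L)       ≡⟨ length-filter-∁ (_∈? L) S ⟨
    length S                                         ∎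
    where
    open ≤-Reasoning
    L⊆S∩L : L ⊆ filter (_∈? L) S
    L⊆S∩L x∈L = ∈-filter⁺ (_∈? L) (L⊆S x∈L) x∈L

  module _ {I : Set} where

    length-concatMap-∖ : ∀ L (f : I → List A) is → All (Unique ∘ f) is → All (MeetInAtMostOne L ∘ f) is →
                         length (concatMap f is) ≤ length (concatMap ((_∖ L) ∘ f) is) + length is
    length-concatMap-∖ L f []       []         []             = z≤n
    length-concatMap-∖ L f (i ∷ is) (uf ∷ ufs) (meet ∷ meets) = begin
      length (f i ++ concatMap f is)
        ≡⟨ length-++ (f i) ⟩
      length (f i) + length (concatMap f is)
        ≤⟨ +-mono-≤ (length≤1+length-∖ uf meet) (length-concatMap-∖ L f is ufs meets) ⟩
      suc (length (f i ∖ L)) + (length (concatMap f′ is) + length is)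
        ≡⟨ shuffle (length (f i ∖ L)) _ _ ⟩
      length (f i ∖ L) + length (concatMap f′ is) + suc (length is)
        ≡⟨ cong (_+ suc (length is)) (length-++ (f i ∖ L)) ⟨
      length (concatMap f′ (i ∷ is)) + suc (length is)
        ∎
      where
      open ≤-Reasoning
      f′ = (_∖ L) ∘ f
      shuffle : ∀ a b c → suc a + (b + c) ≡ (a + b) + suc c
      shuffle = solve-∀

    -- Remove the points of f i from S and from every later list; each later list loses at most one point.
    length-concatMap≤ : ∀ {S} (f : I → List A) is → Unique S → All (Unique ∘ f) is → All ((_⊆ S) ∘ f) is →
                        AllPairs (MeetInAtMostOne on f) is →
                        length (concatMap f is) ≤ length S + length is C 2
    length-concatMap≤     f []       _  _          _               _                = z≤n
    length-concatMap≤ {S} f (i ∷ is) uS (uf ∷ ufs) (fi⊆S ∷ fis⊆S) (meets ∷ meetss) = begin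
      length (f i ++ concatMap f is)
        ≡⟨ length-++ (f i) ⟩
      length (f i) + length (concatMap f is)
        ≤⟨ +-monoʳ-≤ (length (f i)) (length-concatMap-∖ (f i) f is ufs meets) ⟩
      length (f i) + (length (concatMap f′ is) + length is)
        ≤⟨ +-monoʳ-≤ (length (f i)) (+-monoˡ-≤ (length is) rest) ⟩
      length (f i) + (length (S ∖ f i) + length is C 2 + length is)
        ≡⟨ regroup (length (f i)) _ _ _ ⟩
      length (f i) + length (S ∖ f i) + (length is + length is C 2)
        ≤⟨ +-monoˡ-≤ _ (length+length-∖≤ uf fi⊆S) ⟩
      length S + (length is + length is C 2)
        ≡⟨ cong (length S +_) ([1+n]C2≡n+nC2 (length is)) ⟨
      length S + suc (length is) C 2
        ∎
      where
      open ≤-Reasoning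
      f′ = (_∖ f i) ∘ f
      regroup : ∀ a b c d → a + (b + c + d) ≡ a + b + (d + c)
      regroup = solve-∀
      rest : length (concatMap f′ is) ≤ length (S ∖ f i) + length is C 2
      rest = length-concatMap≤ f′ is (Unique.filter⁺ _ uS)
        (All.map (Unique.filter⁺ _) ufs)
        (All.map (∖-mono (f i)) fis⊆S)
        (AllPairs.map (MeetInAtMostOne-⊆ (∖-⊆ (f i)) (∖-⊆ (f i))) meetss)

module Secants {q} (F : FiniteField q) where
  open FiniteField F using (_≟_; elements; elements-length)
  open Plane F
  open AffinePlane F

  _≟ₚ_ : DecidableEquality Point
  _≟ₚ_ = ≡-dec _≟_ _≟_

  open Counting _≟ₚ_

  -- Definitionally pointsOn (secant a b a≢b), but needs no proof of a ≢ b.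
  secantPoints : Point × Point → List Point
  secantPoints (a , b) = map (λ t → a +ᵥ t ·ᵥ (b -ᵥ a)) elements

  length-secantPoints : ∀ p → length (secantPoints p) ≡ q
  length-secantPoints p = trans (length-map _ elements) elements-length

  module _ (P : List Point) (arc : IsArc P) where

    secantPoints-unique : ∀ {p} → p ∈ pairs P → Unique (secantPoints p)
    secantPoints-unique {a , b} p∈ with _ , _ , a≢b ← ∈-pairs⁻ (proj₁ arc) p∈ =
      pointsOn-unique (secant a b a≢b)

    -- Sharing two points, the secant cd lies inside ab, and then so does whichever of c, d
    -- is not in {a, b}: a third point of P on ab.
    secantPoints-meet : ∀ {a b c d} → a ∈ P → b ∈ P → c ∈ P → d ∈ P → a ≢ b → c ≢ d → (c , d) ⊈₂ (a , b) →
                        MeetInAtMostOne (secantPoints (a , b)) (secantPoints (c , d))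
    secantPoints-meet {a} {b} {c} {d} a∈ b∈ c∈ d∈ a≢b c≢d cd⊈ab {x} {y} x∈ab x∈cd y∈ab y∈cd with x ≟ₚ y
    ... | yes x≡y = x≡y
    ... | no  x≢y = ⊥-elim (cd⊈ab⇒⊥ cd⊈ab)
      where
      ab = secant a b a≢b
      cd = secant c d c≢d
      cd⊆ab : cd ⊆ₗ ab
      cd⊆ab = ⊆ₗ-of-two-common-points cd ab x≢y
        (∈-pointsOn⁻ cd x∈cd) (∈-pointsOn⁻ cd y∈cd) (∈-pointsOn⁻ ab x∈ab) (∈-pointsOn⁻ ab y∈ab)
      offAb : ∀ {e} → e ∈ P → a ≢ e → b ≢ e → ¬ (e ∈ₗ ab)
      offAb e∈ a≢e b≢e = proj₂ arc ab a b _ a∈ b∈ e∈ a≢b a≢e b≢e (start∈secant a≢b) (end∈secant a≢b)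
      cd⊈ab⇒⊥ : (c , d) ⊈₂ (a , b) → ⊥
      cd⊈ab⇒⊥ (inj₁ (a≢c , b≢c)) = offAb c∈ a≢c b≢c (cd⊆ab (start∈secant c≢d))
      cd⊈ab⇒⊥ (inj₂ (a≢d , b≢d)) = offAb d∈ a≢d b≢d (cd⊆ab (end∈secant c≢d))

    secantPoints-pairwise-meet : AllPairs (MeetInAtMostOne on secantPoints) (pairs P)
    secantPoints-pairwise-meet =
      AllPairs-mapWithAll (All.tabulate (∈-pairs⁻ (proj₁ arc))) (pairs-⊈₂ (proj₁ arc))
        λ (a∈ , b∈ , a≢b) (c∈ , d∈ , c≢d) → secantPoints-meet a∈ b∈ c∈ d∈ a≢b c≢d

    ∈-concatMap-secantPoints : ∀ ℓ {a b z} (a≢b : a ≢ b) → a ∈ₗ ℓ → b ∈ₗ ℓ → (a , b) ∈ pairs P → z ∈ₗ ℓ →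
                               z ∈ concatMap secantPoints (pairs P)
    ∈-concatMap-secantPoints ℓ {a} {b} a≢b a∈ℓ b∈ℓ ab∈ z∈ℓ =
      ∈-concat⁺′ (∈-pointsOn⁺ (secant a b a≢b) (⊆ₗ-secant ℓ a≢b a∈ℓ b∈ℓ z∈ℓ)) (∈-map⁺ secantPoints ab∈)

    module _ (S : List Point) (S≡𝓛 : Enumerates𝓛 P S) where

      secantPoints-⊆ : ∀ {p} → p ∈ pairs P → secantPoints p ⊆ S
      secantPoints-⊆ {a , b} p∈ z∈ with a∈ , b∈ , a≢b ← ∈-pairs⁻ (proj₁ arc) p∈ =
        proj₂ (proj₂ S≡𝓛 _) (secant a b a≢b , (a , b , a∈ , b∈ , a≢b , start∈secant a≢b , end∈secant a≢b) ,
                              ∈-pointsOn⁻ (secant a b a≢b) z∈)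

      ⊆-secantPoints : S ⊆ concatMap secantPoints (pairs P)
      ⊆-secantPoints z∈S with ℓ , (a , b , a∈ , b∈ , a≢b , a∈ℓ , b∈ℓ) , z∈ℓ ← proj₁ (proj₂ S≡𝓛 _) z∈S
                          | ∈-pairs⁺ a∈ b∈ a≢b
      ... | inj₁ ab∈ = ∈-concatMap-secantPoints ℓ a≢b a∈ℓ b∈ℓ ab∈ z∈ℓ
      ... | inj₂ ba∈ = ∈-concatMap-secantPoints ℓ (a≢b ∘ sym) b∈ℓ a∈ℓ ba∈ z∈ℓ

lemma5 : (q : ℕ) → IsPrimePower q → (F : FiniteField q) →
         let open Plane F in
         (P : List Point) → IsArc P →
         (k : ℕ) → length P ≡ k → k * k ≤ q →
         (S : List Point) → Enumerates𝓛 P S →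
         (q * (k C 2) ≤ 2 * length S) × (length S ≤ q * (k C 2))
lemma5 q _ F P arc k refl k*k≤q S S≡𝓛 = lower , upper
  where
  open Secants F
  open Counting _≟ₚ_
  N = k C 2
  secantPointsOfP = concatMap secantPoints (pairs P)

  length-secantPointsOfP : length secantPointsOfP ≡ N * q
  length-secantPointsOfP =
    trans (length-concatMap q secantPoints length-secantPoints (pairs P)) (cong (_* q) (length-pairs P))

  bonferroni : length secantPointsOfP ≤ length S + length (pairs P) C 2
  bonferroni = length-concatMap≤ secantPoints (pairs P) (proj₁ S≡𝓛)
    (All.tabulate (secantPoints-unique P arc)) (All.tabulate (secantPoints-⊆ P arc S S≡𝓛))
    (secantPoints-pairwise-meet P arc)

  lower : q * N ≤ 2 * length S
  lower = n*q≤s+nC2⇒q*n≤2*s (≤-trans (nC2≤n*n k) k*k≤q)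
    (subst₂ (λ m n → m ≤ length S + n C 2) length-secantPointsOfP (length-pairs P) bonferroni)

  upper : length S ≤ q * N
  upper = subst (length S ≤_) (trans length-secantPointsOfP (*-comm N q))
    (Unique⇒length≤ (proj₁ S≡𝓛) (⊆-secantPoints P arc S S≡𝓛))
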